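{- Let $m\ge2$, $k\ge1$, $g\ge0$ and $n=m+g(m-1)$. Let $t,t'$ be $m$-ary trees with $n$ leaves, with depths $(\delta^{l_1}(t),\dots,\delta^{l_m}(t))$ and $(\delta^{l_1}(t'),\dots,\delta^{l_m}(t'))$. Then $t$ and $t'$ are $k$-equivalent if and only if $$\sum_{i=1}^{m-1}(m-i)\,\delta^{l_i}(t)\equiv\sum_{i=1}^{m-1}(m-i)\,\delta^{l_i}(t')\pmod{k(m-1)},$$ where addition and congruence of $n$-tuples are componentwise.
   Context: An $m$-ary tree is a rooted tree in which each node has either $0$ or $m$ linearly ordered children; nodes without children are leaves, numbered $1,\dots,n$ from left to right. Each edge joining a node to its $i$-th child is labelled $l_i$; $\delta^{l_i}_j(t)$ is the number of edges labelled $l_i$ on the path from the root to leaf $j$, $\delta^{l_i}(t)=(\delta^{l_i}_1(t),\dots,\delta^{l_i}_n(t))$, and the depth of $t$ is $(\delta^{l_1}(t),\dots,\delta^{l_m}(t))$. Meet: $s_1\wedge\dots\wedge s_m$ is the tree whose root has $s_i$ as subtree at its $i$-th child; longer meets are left-nested, $s_1\wedge\dots\wedge s_{m+h(m-1)}=((\dots((s_1\wedge\dots\wedge s_m)\wedge s_{m+1}\wedge\dots\wedge s_{2m-1})\dots)\wedge\dots\wedge s_{m+h(m-1)})$. A right $k$-rotation at a node $v$ replaces a subtree $t_1\wedge\dots\wedge t_{j-1}\wedge(t_j\wedge\dots\wedge t_{j+k(m-1)})\wedge t_{j+k(m-1)+1}\wedge\dots\wedge t_{m+k(m-1)}$ rooted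 at $v$ ($1\le j\le m-1$, the $t_i$ arbitrary $m$-ary trees, possibly single nodes) by $t_1\wedge\dots\wedge t_j\wedge(t_{j+1}\wedge\dots\wedge t_{j+k(m-1)+1})\wedge t_{j+k(m-1)+2}\wedge\dots\wedge t_{m+k(m-1)}$; a left $k$-rotation is the inverse. Two trees with $n$ leaves are $k$-equivalent if one can be obtained from the other by a finite sequence of right and left $k$-rotations. -}

module Defs where

open import Data.Nat using (ℕ; zero; suc; _+_; _*_; _∸_; _<_; _≟_)
open import Data.List using (List; []; _∷_; _++_; [_]; map; length; take; drop; foldr; zipWith; replicate; upTo; _∷ʳ_)
open import Data.List.Relation.Unary.All using (All)
open import Data.Product using (∃₂)
open import Relation.Binary.PropositionalEquality using (_≡_)
open import Relation.Nullary using (yes; no)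
open import Relation.Binary.Construct.Closure.Equivalence using (EqClosure)

-- Planar rooted trees; children are linearly ordered (left to right).
-- The edge from a node to its (p+1)-th child carries label l_{p+1}.
data Tree : Set where
  leaf : Tree
  node : List Tree → Tree

data IsMary (m : ℕ) : Tree → Set where
  leaf : IsMary m leaf
  node : ∀ {ts} → length ts ≡ m → All (IsMary m) ts → IsMary m (node ts)

mutual
  leaves : Tree → ℕ
  leaves leaf = 1
  leaves (node ts) = leavesL ts

  leavesL : List Tree → ℕ
  leavesL [] = 0
  leavesL (t ∷ ts) = leaves t + leavesL ts

-- delta p t = δ^{l_{p+1}}(t): for each leaf (left to right) the number of
-- edges labelled l_{p+1} on the path from the root to it.
mutual
  delta : ℕ → Tree → List ℕ
  delta p leaf = [ 0 ]
  delta p (node ts) = deltaL p 0 ts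

  -- q = position (0-based) of the first child in the list
  deltaL : ℕ → ℕ → List Tree → List ℕ
  deltaL p q [] = []
  deltaL p q (t ∷ ts) with q ≟ p
  ... | yes _ = map suc (delta p t) ++ deltaL p (suc q) ts
  ... | no  _ = delta p t ++ deltaL p (suc q) ts

-- Σ_{i=1}^{m-1} (m-i) δ^{l_i}(t), componentwise (i = p+1, p = 0..m-2).
weightedDepth : ℕ → Tree → List ℕ
weightedDepth m t =
  foldr (λ p acc → zipWith _+_ (map ((m ∸ suc p) *_) (delta p t)) acc)
        (replicate (leaves t) 0)
        (upTo (m ∸ 1))

-- Left-nested meet of m + h(m-1) trees:
-- bigMeet 0 ts = s_1 ∧ … ∧ s_m ,
-- bigMeet (h+1) ts = (bigMeet h s_1..s_{m+h(m-1)}) ∧ s_{m+h(m-1)+1} ∧ … ∧ s_{m+(h+1)(m-1)}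
bigMeet : ℕ → ℕ → List Tree → Tree
bigMeet m zero ts = node ts
bigMeet m (suc h) ts =
  node (bigMeet m h (take (m + h * (m ∸ 1)) ts) ∷ drop (m + h * (m ∸ 1)) ts)

-- Right k-rotation at some node (k ≥ 1, so the inner meet has k(m-1)+1 = m+(k-1)(m-1) trees).
-- At the root: xs = t_1..t_{j-1}, y = t_j, ys = t_{j+1}..t_{j+k(m-1)}, z = t_{j+k(m-1)+1},
-- zs = t_{j+k(m-1)+2}..t_{m+k(m-1)}, with 1 ≤ j ≤ m-1.
data RightRot (m k : ℕ) : Tree → Tree → Set where
  root : ∀ (xs : List Tree) y ys z zs →
         suc (length xs) < m →
         length ys ≡ k * (m ∸ 1) →
         length xs + 2 + length zs ≡ m →
         RightRot m k
           (node (xs ++ bigMeet m (k ∸ 1) (y ∷ ys) ∷ z ∷ zs))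
           (node (xs ++ y ∷ bigMeet m (k ∸ 1) (ys ∷ʳ z) ∷ zs))
  inside : ∀ (xs : List Tree) s s' zs →
           RightRot m k s s' →
           RightRot m k (node (xs ++ s ∷ zs)) (node (xs ++ s' ∷ zs))

KEquiv : ℕ → ℕ → Tree → Tree → Set
KEquiv m k = EqClosure (RightRot m k)

_≡_[mod_] : ℕ → ℕ → ℕ → Set
a ≡ b [mod d ] = ∃₂ λ x y → a + x * d ≡ b + y * d

-- The weight Σ (m − i) δ^{l_i} of a leaf adds up, along its root path, the number of right
-- siblings of each node. In a left-nested meet every argument still sees exactly the trees to
-- its right, so the meet weighs like one node with all its arguments as children; a k-rotation
-- therefore only moves one subtree past k(m − 1) others, shifting its leaves by k(m − 1).
-- Conversely every tree is k-equivalent to a normal form: a right comb whose other subtrees have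
-- all left spines of fewer than k edges (a longer spine is a meet that rotates into its right
-- sibling). Leaf by leaf, the weights of a normal form are determined by the lengths of the
-- first-child chains ending at the leaves; these lengths are bounded so that each is recovered
-- from its residue, and they determine the tree.
module Submission where

open import Defs
open import Data.Nat using (ℕ; zero; suc; _+_; _*_; _∸_; _≤_; _<_; z≤n; s≤s; s≤s⁻¹; _≟_; _<?_; _≤?_; >-nonZero)
open import Data.Nat.DivMod using (_%_; [m+kn]%n≡m%n; m<n⇒m%n≡m)
open import Data.Nat.Properties
open import Data.Nat.Tactic.RingSolver using (solve-∀)
open import Data.List using (List; []; _∷_; _++_; [_]; map; length; foldr; zipWith; replicate; upTo; _∷ʳ_; take; drop; initLast; _∷ʳ′_)
open import Data.List.Properties using (length-++; length-map; map-++; map-id; upTo-∷ʳ; ∷-injective; ∷-injectiveʳ; ++-assoc; ∷ʳ-++; take++drop≡id; ++-identityʳ)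
open import Data.List.Relation.Binary.Pointwise as Pw using (Pointwise; []; _∷_)
open import Data.Product using (_×_; _,_; proj₁; proj₂; map₁; ∃; ∃₂)
open import Data.List.Relation.Unary.All using (All; []; _∷_)
open import Data.List.Relation.Unary.All.Properties using (++⁺; ++⁻)
open import Relation.Binary.Construct.Closure.ReflexiveTransitive using (ε; _◅_; _◅◅_)
open import Relation.Binary.Construct.Closure.Symmetric using (fwd; bwd)
import Relation.Binary.Construct.Closure.Equivalence as EC
open import Data.Sum using (_⊎_; inj₁; inj₂)
open import Data.Empty using (⊥-elim)
open import Relation.Nullary using (yes; no)
open import Relation.Binary.PropositionalEquality hiding ([_])
open ≡-Reasoning
open import Function.Bundles using (_⇔_; mk⇔)

replicate-++ : ∀ {A : Set} a b (x : A) → replicate (a + b) x ≡ replicate a x ++ replicate b x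
replicate-++ zero    b x = refl
replicate-++ (suc a) b x = cong (x ∷_) (replicate-++ a b x)

zipWith-++ : ∀ {A B C : Set} (f : A → B → C) xs ys us vs → length xs ≡ length us →
             zipWith f (xs ++ ys) (us ++ vs) ≡ zipWith f xs us ++ zipWith f ys vs
zipWith-++ f []       ys []       vs _   = refl
zipWith-++ f (x ∷ xs) ys (u ∷ us) vs len = cong (f x u ∷_) (zipWith-++ f xs ys us vs (suc-injective len))

length-∷ʳ : ∀ {A : Set} (xs : List A) x → length (xs ∷ʳ x) ≡ suc (length xs)
length-∷ʳ xs x = trans (length-++ xs) (+-comm (length xs) 1)

length-++-∷-∷ : ∀ {A : Set} (xs : List A) y z zs → length (xs ++ y ∷ z ∷ zs) ≡ length xs + 2 + length zs
length-++-∷-∷ xs y z zs = trans (length-++ xs {y ∷ z ∷ zs}) (sym (+-assoc (length xs) 2 (length zs)))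

length-++-∷ : ∀ {A : Set} (xs : List A) {y z} zs → length (xs ++ y ∷ zs) ≡ length (xs ++ z ∷ zs)
length-++-∷ []       zs = refl
length-++-∷ (x ∷ xs) zs = cong suc (length-++-∷ xs zs)

splitAt-lengths : ∀ {A : Set} a {b} (us : List A) → length us ≡ a + b →
                  length (take a us) ≡ a × length (drop a us) ≡ b
splitAt-lengths zero    us       len = refl , len
splitAt-lengths (suc a) (u ∷ us) len = map₁ (cong suc) (splitAt-lengths a us (suc-injective len))

take-length-++ : ∀ {A : Set} (xs ys : List A) → take (length xs) (xs ++ ys) ≡ xs
take-length-++ []       ys = refl
take-length-++ (x ∷ xs) ys = cong (x ∷_) (take-length-++ xs ys)

drop-length-++ : ∀ {A : Set} (xs ys : List A) → drop (length xs) (xs ++ ys) ≡ ys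
drop-length-++ []       ys = refl
drop-length-++ (x ∷ xs) ys = drop-length-++ xs ys

-- Weighted depths as path weights

mutual
  pathWeights : (ℕ → ℕ) → Tree → List ℕ
  pathWeights w leaf      = [ 0 ]
  pathWeights w (node ts) = pathWeightsFrom w 0 ts

  pathWeightsFrom : (ℕ → ℕ) → ℕ → List Tree → List ℕ
  pathWeightsFrom w q []       = []
  pathWeightsFrom w q (t ∷ ts) = map (w q +_) (pathWeights w t) ++ pathWeightsFrom w (suc q) ts

mutual
  pathWeights-cong : ∀ {w w′} → (∀ q → w q ≡ w′ q) → ∀ t → pathWeights w t ≡ pathWeights w′ t
  pathWeights-cong w≗w′ leaf      = refl
  pathWeights-cong w≗w′ (node ts) = pathWeightsFrom-cong w≗w′ 0 ts

  pathWeightsFrom-cong : ∀ {w w′} → (∀ q → w q ≡ w′ q) → ∀ q ts →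
                         pathWeightsFrom w q ts ≡ pathWeightsFrom w′ q ts
  pathWeightsFrom-cong w≗w′ q []       = refl
  pathWeightsFrom-cong w≗w′ q (t ∷ ts) =
    cong₂ _++_ (cong₂ (λ c → map (c +_)) (w≗w′ q) (pathWeights-cong w≗w′ t))
               (pathWeightsFrom-cong w≗w′ (suc q) ts)

mutual
  length-pathWeights : ∀ w t → length (pathWeights w t) ≡ leaves t
  length-pathWeights w leaf      = refl
  length-pathWeights w (node ts) = length-pathWeightsFrom w 0 ts

  length-pathWeightsFrom : ∀ w q ts → length (pathWeightsFrom w q ts) ≡ leavesL ts
  length-pathWeightsFrom w q []       = refl
  length-pathWeightsFrom w q (t ∷ ts) = begin
    length (map (w q +_) (pathWeights w t) ++ pathWeightsFrom w (suc q) ts)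
      ≡⟨ length-++ (map (w q +_) (pathWeights w t)) ⟩
    length (map (w q +_) (pathWeights w t)) + length (pathWeightsFrom w (suc q) ts)
      ≡⟨ cong₂ _+_ (trans (length-map (w q +_) (pathWeights w t)) (length-pathWeights w t))
                   (length-pathWeightsFrom w (suc q) ts) ⟩
    leaves t + leavesL ts ∎

mutual
  pathWeights-zero : ∀ t → pathWeights (λ _ → 0) t ≡ replicate (leaves t) 0
  pathWeights-zero leaf      = refl
  pathWeights-zero (node ts) = pathWeightsFrom-zero 0 ts

  pathWeightsFrom-zero : ∀ q ts → pathWeightsFrom (λ _ → 0) q ts ≡ replicate (leavesL ts) 0
  pathWeightsFrom-zero q []       = refl
  pathWeightsFrom-zero q (t ∷ ts) = begin
    map (0 +_) (pathWeights (λ _ → 0) t) ++ pathWeightsFrom (λ _ → 0) (suc q) ts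
      ≡⟨ cong₂ _++_ (trans (map-id _) (pathWeights-zero t)) (pathWeightsFrom-zero (suc q) ts) ⟩
    replicate (leaves t) 0 ++ replicate (leavesL ts) 0
      ≡⟨ replicate-++ (leaves t) (leavesL ts) 0 ⟨
    replicate (leaves t + leavesL ts) 0 ∎

zipWith-scaled-shift : ∀ c a b (xs ys : List ℕ) →
  zipWith _+_ (map (c *_) (map (a +_) xs)) (map (b +_) ys) ≡ map ((c * a + b) +_) (zipWith _+_ (map (c *_) xs) ys)
zipWith-scaled-shift c a b []       ys       = refl
zipWith-scaled-shift c a b (x ∷ xs) []       = refl
zipWith-scaled-shift c a b (x ∷ xs) (y ∷ ys) = cong₂ _∷_ (arith c a b x y) (zipWith-scaled-shift c a b xs ys)
  where
  arith : ∀ c a b x y → c * (a + x) + (b + y) ≡ (c * a + b) + (c * x + y)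
  arith = solve-∀

mutual
  pathWeights-linear : ∀ c u w t →
    zipWith _+_ (map (c *_) (pathWeights u t)) (pathWeights w t) ≡ pathWeights (λ q → c * u q + w q) t
  pathWeights-linear c u w leaf      = cong [_] (trans (+-identityʳ (c * 0)) (*-zeroʳ c))
  pathWeights-linear c u w (node ts) = pathWeightsFrom-linear c u w 0 ts

  pathWeightsFrom-linear : ∀ c u w q ts →
    zipWith _+_ (map (c *_) (pathWeightsFrom u q ts)) (pathWeightsFrom w q ts)
      ≡ pathWeightsFrom (λ q → c * u q + w q) q ts
  pathWeightsFrom-linear c u w q []       = refl
  pathWeightsFrom-linear c u w q (t ∷ ts) = begin
    zipWith _+_ (map (c *_) (U ++ Us)) (map (w q +_) (pathWeights w t) ++ Ws)
      ≡⟨ cong (λ xs → zipWith _+_ xs (map (w q +_) (pathWeights w t) ++ Ws)) (map-++ (c *_) U Us) ⟩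
    zipWith _+_ (map (c *_) U ++ map (c *_) Us) (map (w q +_) (pathWeights w t) ++ Ws)
      ≡⟨ zipWith-++ _+_ (map (c *_) U) (map (c *_) Us) _ Ws lengths ⟩
    zipWith _+_ (map (c *_) U) (map (w q +_) (pathWeights w t)) ++ zipWith _+_ (map (c *_) Us) Ws
      ≡⟨ cong₂ _++_ (zipWith-scaled-shift c (u q) (w q) (pathWeights u t) (pathWeights w t))
                    (pathWeightsFrom-linear c u w (suc q) ts) ⟩
    map ((c * u q + w q) +_) (zipWith _+_ (map (c *_) (pathWeights u t)) (pathWeights w t))
      ++ pathWeightsFrom (λ q → c * u q + w q) (suc q) ts
      ≡⟨ cong (λ xs → map ((c * u q + w q) +_) xs ++ _) (pathWeights-linear c u w t) ⟩
    pathWeightsFrom (λ q → c * u q + w q) q (t ∷ ts) ∎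
    where
    U  = map (u q +_) (pathWeights u t)
    Us = pathWeightsFrom u (suc q) ts
    Ws = pathWeightsFrom w (suc q) ts
    lengths : length (map (c *_) U) ≡ length (map (w q +_) (pathWeights w t))
    lengths = begin
      length (map (c *_) U)                  ≡⟨ length-map (c *_) U ⟩
      length U                               ≡⟨ length-map (u q +_) (pathWeights u t) ⟩
      length (pathWeights u t)               ≡⟨ length-pathWeights u t ⟩
      leaves t                               ≡⟨ length-pathWeights w t ⟨
      length (pathWeights w t)               ≡⟨ length-map (w q +_) (pathWeights w t) ⟨
      length (map (w q +_) (pathWeights w t)) ∎

indicator : ℕ → ℕ → ℕ
indicator p q with q ≟ p
... | yes _ = 1
... | no  _ = 0

indicator-≢ : ∀ {p q} → q ≢ p → indicator p q ≡ 0
indicator-≢ {p} {q} q≢p with q ≟ p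
... | yes q≡p = ⊥-elim (q≢p q≡p)
... | no  _   = refl

mutual
  delta≡pathWeights : ∀ p t → delta p t ≡ pathWeights (indicator p) t
  delta≡pathWeights p leaf      = refl
  delta≡pathWeights p (node ts) = deltaL≡pathWeightsFrom p 0 ts

  deltaL≡pathWeightsFrom : ∀ p q ts → deltaL p q ts ≡ pathWeightsFrom (indicator p) q ts
  deltaL≡pathWeightsFrom p q []       = refl
  deltaL≡pathWeightsFrom p q (t ∷ ts) with q ≟ p
  ... | yes refl = cong₂ _++_ (cong (map suc) (delta≡pathWeights q t)) (deltaL≡pathWeightsFrom q (suc q) ts)
  ... | no  _    = cong₂ _++_ (trans (sym (map-id (delta p t))) (cong (map (0 +_)) (delta≡pathWeights p t)))
                              (deltaL≡pathWeightsFrom p (suc q) ts)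

labelSum : (ℕ → ℕ) → List ℕ → ℕ → ℕ
labelSum v []       q = 0
labelSum v (p ∷ ps) q = v p * indicator p q + labelSum v ps q

weightedSum≡pathWeights : ∀ v t ps →
  foldr (λ p acc → zipWith _+_ (map (v p *_) (delta p t)) acc) (replicate (leaves t) 0) ps
    ≡ pathWeights (labelSum v ps) t
weightedSum≡pathWeights v t []       = sym (pathWeights-zero t)
weightedSum≡pathWeights v t (p ∷ ps) = begin
  zipWith _+_ (map (v p *_) (delta p t)) (foldr _ (replicate (leaves t) 0) ps)
    ≡⟨ cong₂ (λ δ acc → zipWith _+_ (map (v p *_) δ) acc) (delta≡pathWeights p t) (weightedSum≡pathWeights v t ps) ⟩
  zipWith _+_ (map (v p *_) (pathWeights (indicator p) t)) (pathWeights (labelSum v ps) t)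
    ≡⟨ pathWeights-linear (v p) (indicator p) (labelSum v ps) t ⟩
  pathWeights (labelSum v (p ∷ ps)) t ∎

labelSum-∷ʳ : ∀ v ps p q → labelSum v (ps ∷ʳ p) q ≡ labelSum v ps q + v p * indicator p q
labelSum-∷ʳ v []        p q = +-identityʳ _
labelSum-∷ʳ v (p′ ∷ ps) p q =
  trans (cong (v p′ * indicator p′ q +_) (labelSum-∷ʳ v ps p q)) (sym (+-assoc (v p′ * indicator p′ q) _ _))

labelSum-upTo-≥ : ∀ v n {q} → n ≤ q → labelSum v (upTo n) q ≡ 0
labelSum-upTo-≥ v zero    _     = refl
labelSum-upTo-≥ v (suc n) {q} n<q = begin
  labelSum v (upTo (suc n)) q            ≡⟨ cong (λ ps → labelSum v ps q) (upTo-∷ʳ n) ⟨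
  labelSum v (upTo n ∷ʳ n) q             ≡⟨ labelSum-∷ʳ v (upTo n) n q ⟩
  labelSum v (upTo n) q + v n * indicator n q
    ≡⟨ cong₂ (λ a b → a + v n * b) (labelSum-upTo-≥ v n (<⇒≤ n<q)) (indicator-≢ (>⇒≢ n<q)) ⟩
  v n * 0                                ≡⟨ *-zeroʳ (v n) ⟩
  0                                      ∎

labelSum-upTo-< : ∀ v n {q} → q < n → labelSum v (upTo n) q ≡ v q
labelSum-upTo-< v (suc n) {q} q<1+n = begin
  labelSum v (upTo (suc n)) q            ≡⟨ cong (λ ps → labelSum v ps q) (upTo-∷ʳ n) ⟨
  labelSum v (upTo n ∷ʳ n) q             ≡⟨ labelSum-∷ʳ v (upTo n) n q ⟩
  labelSum v (upTo n) q + v n * indicator n q ≡⟨ last ⟩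
  v q                                    ∎
  where
  last : labelSum v (upTo n) q + v n * indicator n q ≡ v q
  last with q ≟ n
  ... | yes refl = cong₂ _+_ (labelSum-upTo-≥ v q ≤-refl) (*-identityʳ (v q))
  ... | no  q≢n  = begin
    labelSum v (upTo n) q + v n * 0
      ≡⟨ cong (λ a → a + v n * 0) (labelSum-upTo-< v n (≤∧≢⇒< (s≤s⁻¹ q<1+n) q≢n)) ⟩
    v q + v n * 0                        ≡⟨ cong (v q +_) (*-zeroʳ (v n)) ⟩
    v q + 0                              ≡⟨ +-identityʳ (v q) ⟩
    v q                                  ∎

-- Label l_(q+1) has weight m − (q+1): the number of right siblings of a (q+1)-th child.
rightSiblings : ℕ → ℕ → ℕ
rightSiblings m q = m ∸ suc q

weightedDepth≡pathWeights : ∀ m t → weightedDepth m t ≡ pathWeights (rightSiblings m) t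
weightedDepth≡pathWeights m t =
  trans (weightedSum≡pathWeights (rightSiblings m) t (upTo (m ∸ 1))) (pathWeights-cong labelSum≡ t)
  where
  labelSum≡ : ∀ q → labelSum (rightSiblings m) (upTo (m ∸ 1)) q ≡ rightSiblings m q
  labelSum≡ q with q <? m ∸ 1
  ... | yes q<m-1 = labelSum-upTo-< (rightSiblings m) (m ∸ 1) q<m-1
  ... | no  q≮m-1 = trans (labelSum-upTo-≥ (rightSiblings m) (m ∸ 1) (≮⇒≥ q≮m-1))
                          (sym (m≤n⇒m∸n≡0 (≤-trans (m≤n+m∸n m 1) (s≤s (≮⇒≥ q≮m-1)))))

module _ {d : ℕ} where

  ≡[mod]-refl : ∀ {a} → a ≡ a [mod d ]
  ≡[mod]-refl = 0 , 0 , refl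

  ≡[mod]-sym : ∀ {a b} → a ≡ b [mod d ] → b ≡ a [mod d ]
  ≡[mod]-sym (x , y , eq) = y , x , sym eq

  ≡[mod]-trans : ∀ {a b c} → a ≡ b [mod d ] → b ≡ c [mod d ] → a ≡ c [mod d ]
  ≡[mod]-trans {a} {b} {c} (x , y , a≡b) (u , v , b≡c) = x + u , y + v , +-cancelʳ-≡ b _ _ (begin
    a + (x + u) * d + b         ≡⟨ regroup a x u d b ⟩
    (a + x * d) + (b + u * d)   ≡⟨ cong₂ _+_ a≡b b≡c ⟩
    (b + y * d) + (c + v * d)   ≡⟨ regroup′ b y c v d ⟩
    c + (y + v) * d + b         ∎)
    where
    regroup : ∀ a x u d b → a + (x + u) * d + b ≡ (a + x * d) + (b + u * d)
    regroup = solve-∀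
    regroup′ : ∀ b y c v d → (b + y * d) + (c + v * d) ≡ c + (y + v) * d + b
    regroup′ = solve-∀

  +-congˡ-[mod] : ∀ e {a b} → a ≡ b [mod d ] → (e + a) ≡ (e + b) [mod d ]
  +-congˡ-[mod] e {a} {b} (x , y , eq) = x , y , (begin
    e + a + x * d    ≡⟨ +-assoc e a _ ⟩
    e + (a + x * d)  ≡⟨ cong (e +_) eq ⟩
    e + (b + y * d)  ≡⟨ +-assoc e b _ ⟨
    e + b + y * d    ∎)

  +-absorbˡ-[mod] : ∀ a → (d + a) ≡ a [mod d ]
  +-absorbˡ-[mod] a = 0 , 1 , (begin
    d + a + 0 * d  ≡⟨ +-identityʳ (d + a) ⟩
    d + a          ≡⟨ +-comm d a ⟩
    a + d          ≡⟨ cong (a +_) (+-identityʳ d) ⟨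
    a + 1 * d      ∎)

Congruent : ℕ → List ℕ → List ℕ → Set
Congruent d = Pointwise (λ a b → a ≡ b [mod d ])

module _ {d : ℕ} where

  congruent-refl : ∀ {xs} → Congruent d xs xs
  congruent-refl = Pw.refl ≡[mod]-refl

  congruent-sym : ∀ {xs ys} → Congruent d xs ys → Congruent d ys xs
  congruent-sym = Pw.symmetric ≡[mod]-sym

  congruent-trans : ∀ {xs ys zs} → Congruent d xs ys → Congruent d ys zs → Congruent d xs zs
  congruent-trans = Pw.transitive ≡[mod]-trans

  congruent-shift : ∀ e {xs ys} → Congruent d xs ys → Congruent d (map (e +_) xs) (map (e +_) ys)
  congruent-shift e xs≋ys = Pw.map⁺ (e +_) (e +_) (Pw.map (+-congˡ-[mod] e) xs≋ys)

  congruent-absorb : ∀ a xs → Congruent d (map ((d + a) +_) xs) (map (a +_) xs)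
  congruent-absorb a []       = []
  congruent-absorb a (x ∷ xs) =
    subst (_≡ (a + x) [mod d ]) (sym (+-assoc d a x)) (+-absorbˡ-[mod] (a + x)) ∷ congruent-absorb a xs

-- Invariance under rotations

siblingDepth : ℕ → Tree → List ℕ
siblingDepth m = pathWeights (rightSiblings m)

forestDepth : ℕ → ℕ → List Tree → List ℕ
forestDepth m e []       = []
forestDepth m e (t ∷ ts) = map ((e + length ts) +_) (siblingDepth m t) ++ forestDepth m e ts

pathWeightsFrom-++ : ∀ w q xs ys →
  pathWeightsFrom w q (xs ++ ys) ≡ pathWeightsFrom w q xs ++ pathWeightsFrom w (q + length xs) ys
pathWeightsFrom-++ w q []       ys = cong (λ q → pathWeightsFrom w q ys) (sym (+-identityʳ q))
pathWeightsFrom-++ w q (x ∷ xs) ys = begin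
  map (w q +_) (pathWeights w x) ++ pathWeightsFrom w (suc q) (xs ++ ys)
    ≡⟨ cong (map (w q +_) (pathWeights w x) ++_) (pathWeightsFrom-++ w (suc q) xs ys) ⟩
  map (w q +_) (pathWeights w x) ++ (pathWeightsFrom w (suc q) xs ++ pathWeightsFrom w (suc q + length xs) ys)
    ≡⟨ ++-assoc (map (w q +_) (pathWeights w x)) _ _ ⟨
  pathWeightsFrom w q (x ∷ xs) ++ pathWeightsFrom w (suc q + length xs) ys
    ≡⟨ cong (λ q′ → pathWeightsFrom w q (x ∷ xs) ++ pathWeightsFrom w q′ ys) (+-suc q (length xs)) ⟨
  pathWeightsFrom w q (x ∷ xs) ++ pathWeightsFrom w (q + length (x ∷ xs)) ys ∎

module _ (m : ℕ) where

  pathWeightsFrom≡forestDepth : ∀ q ts → q + length ts ≡ m → pathWeightsFrom (rightSiblings m) q ts ≡ forestDepth m 0 ts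
  pathWeightsFrom≡forestDepth q []       _   = refl
  pathWeightsFrom≡forestDepth q (t ∷ ts) len =
    cong₂ (λ a xs → map (a +_) (siblingDepth m t) ++ xs) rightSiblings≡
          (pathWeightsFrom≡forestDepth (suc q) ts (trans (sym (+-suc q (length ts))) len))
    where
    rightSiblings≡ : m ∸ suc q ≡ length ts
    rightSiblings≡ = begin
      m ∸ suc q                     ≡⟨ cong (_∸ suc q) len ⟨
      q + suc (length ts) ∸ suc q   ≡⟨ cong (_∸ suc q) (+-suc q (length ts)) ⟩
      suc q + length ts ∸ suc q     ≡⟨ m+n∸m≡n (suc q) (length ts) ⟩
      length ts                     ∎

  siblingDepth-node : ∀ ts → length ts ≡ m → siblingDepth m (node ts) ≡ forestDepth m 0 ts
  siblingDepth-node ts = pathWeightsFrom≡forestDepth 0 ts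

  forestDepth-++ : ∀ e xs ys → forestDepth m e (xs ++ ys) ≡ forestDepth m (e + length ys) xs ++ forestDepth m e ys
  forestDepth-++ e []       ys = refl
  forestDepth-++ e (x ∷ xs) ys = begin
    map ((e + length (xs ++ ys)) +_) (siblingDepth m x) ++ forestDepth m e (xs ++ ys)
      ≡⟨ cong₂ (λ a zs → map (a +_) (siblingDepth m x) ++ zs) offset≡ (forestDepth-++ e xs ys) ⟩
    map ((e + length ys + length xs) +_) (siblingDepth m x) ++ (forestDepth m (e + length ys) xs ++ forestDepth m e ys)
      ≡⟨ ++-assoc (map ((e + length ys + length xs) +_) (siblingDepth m x)) _ _ ⟨
    forestDepth m (e + length ys) (x ∷ xs) ++ forestDepth m e ys ∎
    where
    offset≡ : e + length (xs ++ ys) ≡ e + length ys + length xs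
    offset≡ = begin
      e + length (xs ++ ys)         ≡⟨ cong (e +_) (length-++ xs) ⟩
      e + (length xs + length ys)   ≡⟨ cong (e +_) (+-comm (length xs) (length ys)) ⟩
      e + (length ys + length xs)   ≡⟨ +-assoc e (length ys) (length xs) ⟨
      e + length ys + length xs     ∎

  map-forestDepth : ∀ a e xs → map (a +_) (forestDepth m e xs) ≡ forestDepth m (a + e) xs
  map-forestDepth a e []       = refl
  map-forestDepth a e (x ∷ xs) = begin
    map (a +_) (map ((e + length xs) +_) (siblingDepth m x) ++ forestDepth m e xs)
      ≡⟨ map-++ (a +_) (map ((e + length xs) +_) (siblingDepth m x)) (forestDepth m e xs) ⟩
    map (a +_) (map ((e + length xs) +_) (siblingDepth m x)) ++ map (a +_) (forestDepth m e xs)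
      ≡⟨ cong₂ _++_ (map-+-+ (siblingDepth m x)) (map-forestDepth a e xs) ⟩
    map ((a + e + length xs) +_) (siblingDepth m x) ++ forestDepth m (a + e) xs ∎
    where
    map-+-+ : ∀ ys → map (a +_) (map ((e + length xs) +_) ys) ≡ map ((a + e + length xs) +_) ys
    map-+-+ []       = refl
    map-+-+ (y ∷ ys) = cong₂ _∷_ (trans (sym (+-assoc a _ y)) (cong (_+ y) (sym (+-assoc a e _)))) (map-+-+ ys)

  forestDepth-flatten : ∀ s us e zs → siblingDepth m s ≡ forestDepth m 0 us →
                        forestDepth m e (s ∷ zs) ≡ forestDepth m e (us ++ zs)
  forestDepth-flatten s us e zs s≡us = begin
    map ((e + length zs) +_) (siblingDepth m s) ++ forestDepth m e zs
      ≡⟨ cong (λ xs → map ((e + length zs) +_) xs ++ forestDepth m e zs) s≡us ⟩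
    map ((e + length zs) +_) (forestDepth m 0 us) ++ forestDepth m e zs
      ≡⟨ cong (_++ forestDepth m e zs) (map-forestDepth (e + length zs) 0 us) ⟩
    forestDepth m (e + length zs + 0) us ++ forestDepth m e zs
      ≡⟨ cong (λ a → forestDepth m a us ++ forestDepth m e zs) (+-identityʳ (e + length zs)) ⟩
    forestDepth m (e + length zs) us ++ forestDepth m e zs
      ≡⟨ forestDepth-++ e us zs ⟨
    forestDepth m e (us ++ zs) ∎

meetLength-suc : ∀ n h → suc n + suc h * n ≡ (suc n + h * n) + n
meetLength-suc = solve-∀

-- Along a left-nested meet each edge still weighs the number of trees to its right,
-- so the meet has the depths of a single node with all of us as children.
siblingDepth-bigMeet : ∀ n h us → length us ≡ suc n + h * n →
                       siblingDepth (suc n) (bigMeet (suc n) h us) ≡ forestDepth (suc n) 0 us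
siblingDepth-bigMeet n zero    us len = siblingDepth-node (suc n) us (trans len (+-identityʳ (suc n)))
siblingDepth-bigMeet n (suc h) us len = begin
  siblingDepth (suc n) (node (bigMeet (suc n) h (take s us) ∷ drop s us))
    ≡⟨ siblingDepth-node (suc n) (bigMeet (suc n) h (take s us) ∷ drop s us) (cong suc (proj₂ lengths)) ⟩
  forestDepth (suc n) 0 (bigMeet (suc n) h (take s us) ∷ drop s us)
    ≡⟨ forestDepth-flatten (suc n) (bigMeet (suc n) h (take s us)) (take s us) 0 (drop s us)
                           (siblingDepth-bigMeet n h (take s us) (proj₁ lengths)) ⟩
  forestDepth (suc n) 0 (take s us ++ drop s us)
    ≡⟨ cong (forestDepth (suc n) 0) (take++drop≡id s us) ⟩
  forestDepth (suc n) 0 us ∎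
  where
  s = suc n + h * n
  lengths : length (take s us) ≡ s × length (drop s us) ≡ n
  lengths = splitAt-lengths s us (trans len (meetLength-suc n h))

module _ (n k : ℕ) where  -- (n+1)-ary trees and (k+1)-rotations

  rightRotation-congruent-root : ∀ xs y ys z zs → length ys ≡ suc k * n → length xs + 2 + length zs ≡ suc n →
    Congruent (suc k * n) (siblingDepth (suc n) (node (xs ++ bigMeet (suc n) k (y ∷ ys) ∷ z ∷ zs)))
                          (siblingDepth (suc n) (node (xs ++ y ∷ bigMeet (suc n) k (ys ∷ʳ z) ∷ zs)))
  rightRotation-congruent-root xs y ys z zs |ys| |node| =
    subst₂ (Congruent (suc k * n)) (sym before) (sym after)
      (Pw.++⁺ˡ ≡[mod]-refl (forestDepth (suc n) (2 + length zs) xs)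
        (Pw.++⁺ʳ ≡[mod]-refl (forestDepth (suc n) 0 (ys ++ z ∷ zs))
          (subst (λ a → Congruent (suc k * n) (map (a +_) (siblingDepth (suc n) y)) _)
                 (sym offset≡) (congruent-absorb (suc (length zs)) (siblingDepth (suc n) y)))))
    where
    M  = bigMeet (suc n) k (y ∷ ys)
    M′ = bigMeet (suc n) k (ys ∷ʳ z)
    length-node : ∀ s t → length (xs ++ s ∷ t ∷ zs) ≡ suc n
    length-node s t = trans (length-++-∷-∷ xs s t zs) |node|
    offset≡ : length (ys ++ z ∷ zs) ≡ suc k * n + suc (length zs)
    offset≡ = trans (length-++ ys) (cong (_+ suc (length zs)) |ys|)
    |ys∷ʳz| : length (ys ∷ʳ z) ≡ suc n + k * n
    |ys∷ʳz| = trans (length-∷ʳ ys z) (cong suc |ys|)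
    before : siblingDepth (suc n) (node (xs ++ M ∷ z ∷ zs))
      ≡ forestDepth (suc n) (2 + length zs) xs
          ++ (map (length (ys ++ z ∷ zs) +_) (siblingDepth (suc n) y) ++ forestDepth (suc n) 0 (ys ++ z ∷ zs))
    before = begin
      siblingDepth (suc n) (node (xs ++ M ∷ z ∷ zs))
        ≡⟨ siblingDepth-node (suc n) (xs ++ M ∷ z ∷ zs) (length-node M z) ⟩
      forestDepth (suc n) 0 (xs ++ M ∷ z ∷ zs)
        ≡⟨ forestDepth-++ (suc n) 0 xs (M ∷ z ∷ zs) ⟩
      forestDepth (suc n) (2 + length zs) xs ++ forestDepth (suc n) 0 (M ∷ z ∷ zs)
        ≡⟨ cong (forestDepth (suc n) (2 + length zs) xs ++_)
                (forestDepth-flatten (suc n) M (y ∷ ys) 0 (z ∷ zs) (siblingDepth-bigMeet n k (y ∷ ys) (cong suc |ys|))) ⟩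
      forestDepth (suc n) (2 + length zs) xs ++ forestDepth (suc n) 0 (y ∷ ys ++ z ∷ zs) ∎
    after : siblingDepth (suc n) (node (xs ++ y ∷ M′ ∷ zs))
      ≡ forestDepth (suc n) (2 + length zs) xs
          ++ (map (suc (length zs) +_) (siblingDepth (suc n) y) ++ forestDepth (suc n) 0 (ys ++ z ∷ zs))
    after = begin
      siblingDepth (suc n) (node (xs ++ y ∷ M′ ∷ zs))
        ≡⟨ siblingDepth-node (suc n) (xs ++ y ∷ M′ ∷ zs) (length-node y M′) ⟩
      forestDepth (suc n) 0 (xs ++ y ∷ M′ ∷ zs)
        ≡⟨ forestDepth-++ (suc n) 0 xs (y ∷ M′ ∷ zs) ⟩
      forestDepth (suc n) (2 + length zs) xs
        ++ (map (suc (length zs) +_) (siblingDepth (suc n) y) ++ forestDepth (suc n) 0 (M′ ∷ zs))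
        ≡⟨ cong (λ ws → forestDepth (suc n) (2 + length zs) xs ++ (map (suc (length zs) +_) (siblingDepth (suc n) y) ++ ws))
                (trans (forestDepth-flatten (suc n) M′ (ys ∷ʳ z) 0 zs (siblingDepth-bigMeet n k (ys ∷ʳ z) |ys∷ʳz|))
                       (cong (forestDepth (suc n) 0) (∷ʳ-++ ys z zs))) ⟩
      forestDepth (suc n) (2 + length zs) xs
        ++ (map (suc (length zs) +_) (siblingDepth (suc n) y) ++ forestDepth (suc n) 0 (ys ++ z ∷ zs)) ∎

  rightRotation-congruent : ∀ {s s′} → RightRot (suc n) (suc k) s s′ →
                            Congruent (suc k * n) (siblingDepth (suc n) s) (siblingDepth (suc n) s′)
  rightRotation-congruent (root xs y ys z zs _ |ys| |node|) = rightRotation-congruent-root xs y ys z zs |ys| |node|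
  rightRotation-congruent (inside xs s s′ zs s↝s′) =
    subst₂ (Congruent (suc k * n))
      (sym (pathWeightsFrom-++ (rightSiblings (suc n)) 0 xs (s ∷ zs)))
      (sym (pathWeightsFrom-++ (rightSiblings (suc n)) 0 xs (s′ ∷ zs)))
      (Pw.++⁺ˡ ≡[mod]-refl (pathWeightsFrom (rightSiblings (suc n)) 0 xs)
        (Pw.++⁺ʳ ≡[mod]-refl (pathWeightsFrom (rightSiblings (suc n)) (suc (length xs)) zs)
          (congruent-shift (rightSiblings (suc n) (length xs)) (rightRotation-congruent s↝s′))))

  kEquiv⇒congruent : ∀ {s s′} → KEquiv (suc n) (suc k) s s′ →
                     Congruent (suc k * n) (siblingDepth (suc n) s) (siblingDepth (suc n) s′)
  kEquiv⇒congruent ε                = congruent-refl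
  kEquiv⇒congruent (fwd r ◅ s↝s′) = congruent-trans (rightRotation-congruent r) (kEquiv⇒congruent s↝s′)
  kEquiv⇒congruent (bwd r ◅ s↝s′) = congruent-trans (congruent-sym (rightRotation-congruent r)) (kEquiv⇒congruent s↝s′)

-- Spine codes

spine : Tree → ℕ
spine leaf             = 0
spine (node [])        = 0
spine (node (t ∷ _))   = suc (spine t)

bumpHead : ℕ → List ℕ → List ℕ
bumpHead e []       = []
bumpHead e (x ∷ xs) = e + x ∷ xs

-- One entry per leaf: the number of first-child edges in the maximal such chain ending at it.
mutual
  spineCode : Tree → List ℕ
  spineCode leaf             = [ 0 ]
  spineCode (node [])        = []
  spineCode (node (t ∷ ts))  = bumpHead 1 (spineCode t) ++ spineCodes ts

  spineCodes : List Tree → List ℕ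
  spineCodes []       = []
  spineCodes (t ∷ ts) = spineCode t ++ spineCodes ts

NonEmpty : List ℕ → Set
NonEmpty xs = ∃₂ λ y ys → xs ≡ y ∷ ys

spineCodes-++ : ∀ xs ys → spineCodes (xs ++ ys) ≡ spineCodes xs ++ spineCodes ys
spineCodes-++ []       ys = refl
spineCodes-++ (x ∷ xs) ys = trans (cong (spineCode x ++_) (spineCodes-++ xs ys)) (sym (++-assoc (spineCode x) _ _))

module SpineCodes (n : ℕ) where  -- (n+1)-ary trees

  spineCode-nonEmpty : ∀ {t} → IsMary (suc n) t → NonEmpty (spineCode t)
  spineCode-nonEmpty leaf                       = 0 , [] , refl
  spineCode-nonEmpty (node {t ∷ ts} _ (mt ∷ _)) with spineCode t | spineCode-nonEmpty mt
  ... | _ | x , xs , refl = suc x , xs ++ spineCodes ts , refl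

  -- Read left to right, a code entry x at offset a gives the leaf depth a + n x; the next
  -- leaf then starts one sibling further right, at offset a + n x ∸ 1.
  codeDepths : ℕ → List ℕ → List ℕ
  codeDepths a []       = []
  codeDepths a (x ∷ xs) = a + n * x ∷ codeDepths (a + n * x ∸ 1) xs

  codeDepths-bumpHead : ∀ a xs ys → NonEmpty xs → codeDepths a (bumpHead 1 xs ++ ys) ≡ codeDepths (a + n) (xs ++ ys)
  codeDepths-bumpHead a .(x ∷ xs) ys (x , xs , refl) = cong (λ b → b ∷ codeDepths (b ∸ 1) (xs ++ ys)) (regroup a n x)
    where
    regroup : ∀ a n x → a + n * suc x ≡ a + n + n * x
    regroup = solve-∀

  mutual
    codeDepths-spineCode : ∀ {t} → IsMary (suc n) t → ∀ a rest →
      codeDepths a (spineCode t ++ rest) ≡ map (a +_) (siblingDepth (suc n) t) ++ codeDepths (a ∸ 1) rest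
    codeDepths-spineCode leaf a rest =
      cong₂ _∷_ (cong (a +_) (*-zeroʳ n))
                (cong (λ b → codeDepths (b ∸ 1) rest) (trans (cong (a +_) (*-zeroʳ n)) (+-identityʳ a)))
    codeDepths-spineCode {node (c ∷ cs)} (node |c∷cs| (mc ∷ mcs)) a rest = begin
      codeDepths a ((bumpHead 1 (spineCode c) ++ spineCodes cs) ++ rest)
        ≡⟨ cong (codeDepths a) (++-assoc (bumpHead 1 (spineCode c)) _ rest) ⟩
      codeDepths a (bumpHead 1 (spineCode c) ++ (spineCodes cs ++ rest))
        ≡⟨ codeDepths-bumpHead a (spineCode c) _ (spineCode-nonEmpty mc) ⟩
      codeDepths (a + n) (spineCode c ++ (spineCodes cs ++ rest))
        ≡⟨ cong₂ codeDepths (trans (cong (_∸ 1) (+-suc a (length cs))) (cong (a +_) (suc-injective |c∷cs|)))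
                            (++-assoc (spineCode c) _ rest) ⟨
      codeDepths (a + length (c ∷ cs) ∸ 1) (spineCodes (c ∷ cs) ++ rest)
        ≡⟨ codeDepths-spineCodes (mc ∷ mcs) a rest ⟩
      forestDepth (suc n) a (c ∷ cs) ++ codeDepths (a ∸ 1) rest
        ≡⟨ cong (_++ codeDepths (a ∸ 1) rest) (trans (map-forestDepth (suc n) a 0 (c ∷ cs))
                                                     (cong (λ e → forestDepth (suc n) e (c ∷ cs)) (+-identityʳ a))) ⟨
      map (a +_) (forestDepth (suc n) 0 (c ∷ cs)) ++ codeDepths (a ∸ 1) rest
        ≡⟨ cong (λ ws → map (a +_) ws ++ codeDepths (a ∸ 1) rest) (siblingDepth-node (suc n) (c ∷ cs) |c∷cs|) ⟨
      map (a +_) (siblingDepth (suc n) (node (c ∷ cs))) ++ codeDepths (a ∸ 1) rest ∎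

    codeDepths-spineCodes : ∀ {cs} → All (IsMary (suc n)) cs → ∀ a rest →
      codeDepths (a + length cs ∸ 1) (spineCodes cs ++ rest) ≡ forestDepth (suc n) a cs ++ codeDepths (a ∸ 1) rest
    codeDepths-spineCodes [] a rest = cong (λ b → codeDepths (b ∸ 1) rest) (+-identityʳ a)
    codeDepths-spineCodes {c ∷ cs} (mc ∷ mcs) a rest = begin
      codeDepths (a + suc (length cs) ∸ 1) ((spineCode c ++ spineCodes cs) ++ rest)
        ≡⟨ cong₂ codeDepths (cong (_∸ 1) (+-suc a (length cs))) (++-assoc (spineCode c) (spineCodes cs) rest) ⟩
      codeDepths (a + length cs) (spineCode c ++ (spineCodes cs ++ rest))
        ≡⟨ codeDepths-spineCode mc (a + length cs) _ ⟩
      map ((a + length cs) +_) (siblingDepth (suc n) c) ++ codeDepths (a + length cs ∸ 1) (spineCodes cs ++ rest)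
        ≡⟨ cong (map ((a + length cs) +_) (siblingDepth (suc n) c) ++_) (codeDepths-spineCodes mcs a rest) ⟩
      map ((a + length cs) +_) (siblingDepth (suc n) c) ++ (forestDepth (suc n) a cs ++ codeDepths (a ∸ 1) rest)
        ≡⟨ ++-assoc (map ((a + length cs) +_) (siblingDepth (suc n) c)) _ _ ⟨
      forestDepth (suc n) a (c ∷ cs) ++ codeDepths (a ∸ 1) rest ∎

  siblingDepth≡codeDepths : ∀ {t} → IsMary (suc n) t → siblingDepth (suc n) t ≡ codeDepths 0 (spineCode t)
  siblingDepth≡codeDepths {t} mt = begin
    siblingDepth (suc n) t                       ≡⟨ map-id (siblingDepth (suc n) t) ⟨
    map (0 +_) (siblingDepth (suc n) t)          ≡⟨ ++-identityʳ _ ⟨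
    map (0 +_) (siblingDepth (suc n) t) ++ []    ≡⟨ codeDepths-spineCode mt 0 [] ⟨
    codeDepths 0 (spineCode t ++ [])             ≡⟨ cong (codeDepths 0) (++-identityʳ (spineCode t)) ⟩
    codeDepths 0 (spineCode t)                   ∎

  bumpHead-cancel : ∀ {xs xs′} ys ys′ r r′ → NonEmpty xs → NonEmpty xs′ →
    (bumpHead 1 xs ++ ys) ++ r ≡ (bumpHead 1 xs′ ++ ys′) ++ r′ → xs ++ (ys ++ r) ≡ xs′ ++ (ys′ ++ r′)
  bumpHead-cancel ys ys′ r r′ (x , xs , refl) (x′ , xs′ , refl) eq with ∷-injective eq
  ... | 1+x≡1+x′ , tails≡ =
    cong₂ _∷_ (suc-injective 1+x≡1+x′) (trans (sym (++-assoc xs ys r)) (trans tails≡ (++-assoc xs′ ys′ r′)))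

  leaf≢bumpHead : ∀ {xs} ys r r′ → NonEmpty xs → 0 ∷ r ≢ (bumpHead 1 xs ++ ys) ++ r′
  leaf≢bumpHead ys r r′ (x , xs , refl) ()

  mutual
    spineCode-injective : ∀ {t t′} → IsMary (suc n) t → IsMary (suc n) t′ → ∀ r r′ →
                          spineCode t ++ r ≡ spineCode t′ ++ r′ → t ≡ t′ × r ≡ r′
    spineCode-injective leaf leaf r r′ eq = refl , ∷-injectiveʳ eq
    spineCode-injective leaf (node {c′ ∷ cs′} _ (mc′ ∷ _)) r r′ eq =
      ⊥-elim (leaf≢bumpHead (spineCodes cs′) r r′ (spineCode-nonEmpty mc′) eq)
    spineCode-injective (node {c ∷ cs} _ (mc ∷ _)) leaf r r′ eq =
      ⊥-elim (leaf≢bumpHead (spineCodes cs) r′ r (spineCode-nonEmpty mc) (sym eq))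
    spineCode-injective (node {c ∷ cs} |c∷cs| (mc ∷ mcs)) (node {c′ ∷ cs′} |c′∷cs′| (mc′ ∷ mcs′)) r r′ eq
      with spineCode-injective mc mc′ _ _
             (bumpHead-cancel (spineCodes cs) (spineCodes cs′) r r′ (spineCode-nonEmpty mc) (spineCode-nonEmpty mc′) eq)
    ... | refl , eq′ with spineCodes-injective mcs mcs′ (suc-injective (trans |c∷cs| (sym |c′∷cs′|))) r r′ eq′
    ... | refl , r≡r′ = refl , r≡r′

    spineCodes-injective : ∀ {cs cs′} → All (IsMary (suc n)) cs → All (IsMary (suc n)) cs′ →
      length cs ≡ length cs′ → ∀ r r′ → spineCodes cs ++ r ≡ spineCodes cs′ ++ r′ → cs ≡ cs′ × r ≡ r′
    spineCodes-injective [] [] _ r r′ eq = refl , eq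
    spineCodes-injective {c ∷ cs} {c′ ∷ cs′} (mc ∷ mcs) (mc′ ∷ mcs′) |cs|≡|cs′| r r′ eq
      with spineCode-injective mc mc′ _ _ (trans (sym (++-assoc (spineCode c) (spineCodes cs) r))
                                                  (trans eq (++-assoc (spineCode c′) (spineCodes cs′) r′)))
    ... | refl , eq′ with spineCodes-injective mcs mcs′ (suc-injective |cs|≡|cs′|) r r′ eq′
    ... | refl , r≡r′ = refl , r≡r′

<-≡[mod]⇒≡ : ∀ {k x y} → x < k → y < k → x ≡ y [mod k ] → x ≡ y
<-≡[mod]⇒≡ {k} {x} {y} x<k y<k (p , q , eq) = begin
  x                 ≡⟨ m<n⇒m%n≡m x<k ⟨
  x % k             ≡⟨ [m+kn]%n≡m%n x p k ⟨
  (x + p * k) % k   ≡⟨ cong (_% k) eq ⟩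
  (y + q * k) % k   ≡⟨ [m+kn]%n≡m%n y q k ⟩
  y % k             ≡⟨ m<n⇒m%n≡m y<k ⟩
  y                 ∎
  where instance _ = >-nonZero (≤-<-trans z≤n x<k)

module ValidCodes (n k : ℕ) where  -- (n+2)-ary trees
  open SpineCodes (suc n)

  -- At offset 0 the chain ending at the leaf also contains an edge of the right comb.
  SpineBound : ℕ → ℕ → Set
  SpineBound zero    x = x ≤ k
  SpineBound (suc a) x = x < k

  data ValidCode : ℕ → List ℕ → Set where
    end  : ValidCode 0 [ 0 ]
    step : ∀ {a x xs} → 1 ≤ a + suc n * x → SpineBound a x → ValidCode (a + suc n * x ∸ 1) xs → ValidCode a (x ∷ xs)

  +-*-cancelˡ-[mod] : ∀ a x y → (a + suc n * x) ≡ (a + suc n * y) [mod k * suc n ] → x ≡ y [mod k ]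
  +-*-cancelˡ-[mod] a x y (p , q , eq) = p , q , *-cancelˡ-≡ (x + p * k) (y + q * k) (suc n)
    (+-cancelˡ-≡ a _ _ (trans (sym (regroup a (suc n) x p k)) (trans eq (regroup a (suc n) y q k))))
    where
    regroup : ∀ a d x p k → a + d * x + p * (k * d) ≡ a + d * (x + p * k)
    regroup = solve-∀

  codeEntry-unique : ∀ a {x y} → 1 ≤ a + suc n * x → 1 ≤ a + suc n * y → SpineBound a x → SpineBound a y →
                     (a + suc n * x) ≡ (a + suc n * y) [mod k * suc n ] → x ≡ y
  codeEntry-unique (suc a) {x} {y} _ _ x<k y<k x≡y = <-≡[mod]⇒≡ x<k y<k (+-*-cancelˡ-[mod] (suc a) x y x≡y)
  codeEntry-unique zero {zero}  pos _ _ _ _ = ⊥-elim (<-irrefl refl (≤-trans pos (≤-reflexive (*-zeroʳ n))))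
  codeEntry-unique zero {suc _} {zero} _ pos _ _ _ = ⊥-elim (<-irrefl refl (≤-trans pos (≤-reflexive (*-zeroʳ n))))
  codeEntry-unique zero {suc x} {suc y} _ _ x<k y<k x≡y with +-*-cancelˡ-[mod] zero (suc x) (suc y) x≡y
  ... | p , q , eq = cong suc (<-≡[mod]⇒≡ x<k y<k (p , q , suc-injective eq))

  validCode-unique : ∀ {a xs ys} → ValidCode a xs → ValidCode a ys →
                     Congruent (k * suc n) (codeDepths a xs) (codeDepths a ys) → xs ≡ ys
  validCode-unique end                        end                        _       = refl
  validCode-unique end                        (step {xs = []} _ _ ())    _
  validCode-unique end                        (step {xs = _ ∷ _} _ _ _)  (_ ∷ ())
  validCode-unique (step {xs = []} _ _ ())    end                        _
  validCode-unique (step {xs = _ ∷ _} _ _ _)  end                        (_ ∷ ())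
  validCode-unique {a} (step pos-x bound-x valid-xs) (step pos-y bound-y valid-ys) (head ∷ tail)
    with codeEntry-unique a pos-x pos-y bound-x bound-y head
  ... | refl = cong (_ ∷_) (validCode-unique valid-xs valid-ys tail)

leavesL-++ : ∀ xs ys → leavesL (xs ++ ys) ≡ leavesL xs + leavesL ys
leavesL-++ []       ys = refl
leavesL-++ (x ∷ xs) ys = trans (cong (leaves x +_) (leavesL-++ xs ys)) (sym (+-assoc (leaves x) _ _))

leaves-positive : ∀ {n t} → IsMary (suc n) t → 1 ≤ leaves t
leaves-positive leaf              = s≤s z≤n
leaves-positive (node _ (mt ∷ _)) = ≤-trans (leaves-positive mt) (m≤m+n _ _)

leaves-bigMeet : ∀ m h us → leaves (bigMeet m h us) ≡ leavesL us
leaves-bigMeet m zero    us = refl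
leaves-bigMeet m (suc h) us = begin
  leaves (bigMeet m h (take s us)) + leavesL (drop s us) ≡⟨ cong (_+ leavesL (drop s us)) (leaves-bigMeet m h (take s us)) ⟩
  leavesL (take s us) + leavesL (drop s us)             ≡⟨ leavesL-++ (take s us) (drop s us) ⟨
  leavesL (take s us ++ drop s us)                      ≡⟨ cong leavesL (take++drop≡id s us) ⟩
  leavesL us                                            ∎
  where s = m + h * (m ∸ 1)

module _ (n : ℕ) where

  bigMeet-isMary : ∀ h {us} → All (IsMary (suc n)) us → length us ≡ suc n + h * n → IsMary (suc n) (bigMeet (suc n) h us)
  bigMeet-isMary zero    mus len = node (trans len (+-identityʳ (suc n))) mus
  bigMeet-isMary (suc h) {us} mus len =
    node (cong suc (proj₂ lengths)) (bigMeet-isMary h (proj₁ parts) (proj₁ lengths) ∷ proj₂ parts)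
    where
    s = suc n + h * n
    lengths : length (take s us) ≡ s × length (drop s us) ≡ n
    lengths = splitAt-lengths s us (trans len (meetLength-suc n h))
    parts : All (IsMary (suc n)) (take s us) × All (IsMary (suc n)) (drop s us)
    parts = ++⁻ (take s us) (subst (All (IsMary (suc n))) (sym (take++drop≡id s us)) mus)

  spine-bigMeet : ∀ h u us → suc h ≤ spine (bigMeet (suc n) h (u ∷ us))
  spine-bigMeet zero    u us = s≤s z≤n
  spine-bigMeet (suc h) u us = s≤s (spine-bigMeet h u (take (n + h * n) us))

  bigMeet-view : ∀ h {s} → IsMary (suc n) s → suc h ≤ spine s →
    ∃ λ us → s ≡ bigMeet (suc n) h us × length us ≡ suc n + h * n × All (IsMary (suc n)) us
  bigMeet-view zero    {node ts} (node |ts| mts) _ = ts , refl , trans |ts| (sym (+-identityʳ (suc n))) , mts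
  bigMeet-view (suc h) {node (c ∷ cs)} (node |c∷cs| (mc ∷ mcs)) (s≤s long) with bigMeet-view h mc long
  ... | us , refl , |us| , mus = us ++ cs , meet≡ , length≡ , ++⁺ mus mcs
    where
    meet≡ : node (bigMeet (suc n) h us ∷ cs) ≡ bigMeet (suc n) (suc h) (us ++ cs)
    meet≡ rewrite sym |us| | take-length-++ us cs | drop-length-++ us cs = refl
    length≡ : length (us ++ cs) ≡ suc n + suc h * n
    length≡ = trans (length-++ us) (trans (cong₂ _+_ |us| (suc-injective |c∷cs|)) (sym (meetLength-suc n h)))

-- Normal forms

-- (n+2)-ary trees and (k+1)-rotations, so that m ≥ 2 and k ≥ 1 hold by construction.
module NormalForms (n k : ℕ) where
  open SpineCodes (suc n)
  open ValidCodes n (suc k)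

  m : ℕ
  m = suc (suc n)

  infix 4 _∼_
  _∼_ : Tree → Tree → Set
  _∼_ = KEquiv m (suc k)

  data Short : Tree → Set where
    leaf : Short leaf
    node : ∀ {ts} → spine (node ts) ≤ k → All Short ts → Short (node ts)

  data Normal : Tree → Set where
    leaf : Normal leaf
    node : ∀ ps r → All Short ps → Normal r → Normal (node (ps ∷ʳ r))

  spine-short : ∀ {s} → Short s → spine s ≤ k
  spine-short leaf            = z≤n
  spine-short (node bound _) = bound

  bumpHead-zero : ∀ xs → bumpHead 0 xs ≡ xs
  bumpHead-zero []       = refl
  bumpHead-zero (x ∷ xs) = refl

  bumpHead-bumpHead : ∀ e xs ys → NonEmpty xs → bumpHead e (bumpHead 1 xs ++ ys) ≡ bumpHead (suc e) xs ++ ys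
  bumpHead-bumpHead e .(x ∷ xs) ys (x , xs , refl) = cong (_∷ xs ++ ys) (+-suc e x)

  mutual
    validCode-short : ∀ {s} → IsMary m s → Short s → ∀ b e rest →
      SpineBound b (spine s + e) → 1 ≤ b + suc n * e → ValidCode (b + suc n * e ∸ 1) rest →
      ValidCode b (bumpHead e (spineCode s) ++ rest)
    validCode-short leaf _ b e rest bound pos valid =
      subst (λ x → ValidCode b (x ∷ rest)) (sym (+-identityʳ e)) (step pos bound valid)
    validCode-short {node (c ∷ cs)} (node |c∷cs| (mc ∷ mcs)) (node _ (sc ∷ scs)) b e rest bound pos valid =
      subst (ValidCode b) (sym codes≡)
        (validCode-short mc sc b (suc e) (spineCodes cs ++ rest)
                         (subst (SpineBound b) (sym (+-suc (spine c) e)) bound) pos′ valid′)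
      where
      codes≡ : bumpHead e (bumpHead 1 (spineCode c) ++ spineCodes cs) ++ rest
             ≡ bumpHead (suc e) (spineCode c) ++ (spineCodes cs ++ rest)
      codes≡ = trans (cong (_++ rest) (bumpHead-bumpHead e (spineCode c) (spineCodes cs) (spineCode-nonEmpty mc)))
                     (++-assoc (bumpHead (suc e) (spineCode c)) (spineCodes cs) rest)
      offset≡ : b + suc n * e + length cs ≡ b + suc n * suc e
      offset≡ = trans (cong (b + suc n * e +_) (suc-injective |c∷cs|)) (regroup b n e)
        where
        regroup : ∀ b n e → b + suc n * e + suc n ≡ b + suc n * suc e
        regroup = solve-∀
      pos′ : 1 ≤ b + suc n * suc e
      pos′ = ≤-trans pos (≤-trans (m≤m+n (b + suc n * e) (length cs)) (≤-reflexive offset≡))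
      valid′ : ValidCode (b + suc n * suc e ∸ 1) (spineCodes cs ++ rest)
      valid′ = subst (λ a → ValidCode (a ∸ 1) (spineCodes cs ++ rest)) offset≡ (validCode-shorts mcs scs _ rest pos valid)

    validCode-shorts : ∀ {cs} → All (IsMary m) cs → All Short cs → ∀ a rest → 1 ≤ a →
      ValidCode (a ∸ 1) rest → ValidCode (a + length cs ∸ 1) (spineCodes cs ++ rest)
    validCode-shorts [] [] a rest _ valid = subst (λ a → ValidCode (a ∸ 1) rest) (sym (+-identityʳ a)) valid
    validCode-shorts {c ∷ cs} (mc ∷ mcs) (sc ∷ scs) (suc a) rest _ valid =
      subst₂ ValidCode (sym (+-suc a (length cs)))
        (trans (cong (_++ spineCodes cs ++ rest) (bumpHead-zero (spineCode c))) (sym (++-assoc (spineCode c) _ rest)))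
        (validCode-short mc sc (suc (a + length cs)) 0 (spineCodes cs ++ rest)
          (s≤s (subst (_≤ k) (sym (+-identityʳ (spine c))) (spine-short sc))) (s≤s z≤n)
          (subst (λ b → ValidCode (b ∸ 1) (spineCodes cs ++ rest))
                 (sym (trans (cong (suc (a + length cs) +_) (*-zeroʳ (suc n))) (+-identityʳ _)))
                 (validCode-shorts mcs scs (suc a) rest (s≤s z≤n) valid)))

  validCode-normal : ∀ {t} → IsMary m t → Normal t → ValidCode 0 (spineCode t)
  validCode-normal leaf leaf = end
  validCode-normal (node () _) (node [] r _ _)
  validCode-normal (node |t| mts) (node (p ∷ ps) r (sp ∷ sps) nr) with ++⁻ (p ∷ ps) mts
  ... | mp ∷ mps , mr ∷ [] =
    subst (ValidCode 0) (cong (bumpHead 1 (spineCode p) ++_) (sym (spineCodes-++ ps [ r ])))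
      (validCode-short mp sp 0 1 (spineCodes ps ++ spineCode r ++ [])
        (subst (_≤ suc k) (+-comm 1 (spine p)) (s≤s (spine-short sp))) (s≤s z≤n)
        (subst (λ a → ValidCode a (spineCodes ps ++ spineCode r ++ [])) length-ps
          (validCode-shorts mps sps 1 (spineCode r ++ []) (s≤s z≤n)
            (subst (ValidCode 0) (sym (++-identityʳ (spineCode r))) (validCode-normal mr nr)))))
    where
    length-ps : length ps ≡ suc n * 1 ∸ 1
    length-ps = trans (+-cancelʳ-≡ 1 (length ps) n (trans (sym (length-++ ps)) (trans (suc-injective |t|) (+-comm 1 n))))
                      (sym (cong (_∸ 1) (*-identityʳ (suc n))))

  normal-unique : ∀ {N N′} → IsMary m N → IsMary m N′ → Normal N → Normal N′ →
    Congruent (suc k * suc n) (siblingDepth m N) (siblingDepth m N′) → N ≡ N′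
  normal-unique {N} {N′} mN mN′ nN nN′ N≋N′ = proj₁ (spineCode-injective mN mN′ [] [] (cong (_++ []) codes≡))
    where
    codes≡ : spineCode N ≡ spineCode N′
    codes≡ = validCode-unique (validCode-normal mN nN) (validCode-normal mN′ nN′)
               (subst₂ (Congruent (suc k * suc n)) (siblingDepth≡codeDepths mN) (siblingDepth≡codeDepths mN′) N≋N′)

  ∼-node : ∀ xs zs {s s′} → s ∼ s′ → node (xs ++ s ∷ zs) ∼ node (xs ++ s′ ∷ zs)
  ∼-node xs zs = EC.gmap (λ s → node (xs ++ s ∷ zs)) (inside xs _ _ zs)

  leaves-∼ : ∀ {s s′} → s ∼ s′ → leaves s ≡ leaves s′
  leaves-∼ {s} {s′} s∼s′ = begin
    leaves s                                  ≡⟨ length-pathWeights (rightSiblings m) s ⟨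
    length (siblingDepth m s)                 ≡⟨ Pw.Pointwise-length (kEquiv⇒congruent (suc n) k s∼s′) ⟩
    length (siblingDepth m s′)                ≡⟨ length-pathWeights (rightSiblings m) s′ ⟩
    leaves s′                                 ∎

  rightRotation : ∀ xs y ys z zs → length ys ≡ suc k * suc n → length xs + 2 + length zs ≡ m →
    RightRot m (suc k) (node (xs ++ bigMeet m k (y ∷ ys) ∷ z ∷ zs)) (node (xs ++ y ∷ bigMeet m k (ys ∷ʳ z) ∷ zs))
  rightRotation xs y ys z zs |ys| |node| = root xs y ys z zs xs<m |ys| |node|
    where
    xs<m : suc (length xs) < m
    xs<m = ≤-trans (≤-reflexive (+-comm 2 (length xs))) (≤-trans (m≤m+n (length xs + 2) (length zs)) (≤-reflexive |node|))

  data Long : Tree → Set where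
    here  : ∀ {t} → suc k ≤ spine t → Long t
    there : ∀ xs {c} zs → Long c → Long (node (xs ++ c ∷ zs))

  mutual
    short-or-long : ∀ t → Short t ⊎ Long t
    short-or-long leaf = inj₁ leaf
    short-or-long (node ts) with spine (node ts) ≤? k | all-short-or-long ts
    ... | no  long  | _                              = inj₂ (here (≰⇒> long))
    ... | yes short | inj₁ shorts                    = inj₁ (node short shorts)
    ... | yes _     | inj₂ (xs , c , zs , refl , lc) = inj₂ (there xs zs lc)

    all-short-or-long : ∀ ts → All Short ts ⊎ ∃ λ xs → ∃₂ λ c zs → ts ≡ xs ++ c ∷ zs × Long c
    all-short-or-long [] = inj₁ []
    all-short-or-long (t ∷ ts) with short-or-long t | all-short-or-long ts
    ... | inj₂ lt | _                               = inj₂ ([] , t , ts , refl , lt)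
    ... | inj₁ st | inj₁ sts                        = inj₁ (st ∷ sts)
    ... | inj₁ _  | inj₂ (xs , c , zs , refl , lc) = inj₂ (t ∷ xs , c , zs , refl , lc)

  LongAtRoot : Tree → Set
  LongAtRoot s = ∃ λ s′ → s ∼ s′ × IsMary m s′ × suc k ≤ spine s′

  leftRotation : ∀ xs y ys z zs → length ys ≡ suc k * suc n → length ((xs ∷ʳ y) ++ bigMeet m k (ys ∷ʳ z) ∷ zs) ≡ m →
    node ((xs ∷ʳ y) ++ bigMeet m k (ys ∷ʳ z) ∷ zs) ∼ node (xs ++ bigMeet m k (y ∷ ys) ∷ z ∷ zs)
      × length (xs ++ bigMeet m k (y ∷ ys) ∷ z ∷ zs) ≡ m
  leftRotation xs y ys z zs |ys| |node| =
    subst (_∼ node (xs ++ bigMeet m k (y ∷ ys) ∷ z ∷ zs)) (cong node (sym (∷ʳ-++ xs y (bigMeet m k (ys ∷ʳ z) ∷ zs))))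
      (bwd (rightRotation xs y ys z zs |ys| |node|′) ◅ ε) ,
    trans (length-++-∷-∷ xs (bigMeet m k (y ∷ ys)) z zs) |node|′
    where
    |node|′ : length xs + 2 + length zs ≡ m
    |node|′ = trans (sym (length-++-∷-∷ xs y (bigMeet m k (ys ∷ʳ z)) zs))
                    (trans (cong length (sym (∷ʳ-++ xs y (bigMeet m k (ys ∷ʳ z) ∷ zs)))) |node|)

  -- Left rotations move a long spine one sibling to the left, lengthening it by the sibling's edge.
  pullLongLeft : ∀ i xs c zs → length xs ≡ i → length (xs ++ c ∷ zs) ≡ m →
    All (IsMary m) xs → IsMary m c → All (IsMary m) zs → suc k ≤ spine c → LongAtRoot (node (xs ++ c ∷ zs))
  pullLongLeft _ [] c zs _ |c∷zs| _ mc mzs long = node (c ∷ zs) , ε , node |c∷zs| (mc ∷ mzs) , ≤-trans long (n≤1+n _)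
  pullLongLeft (suc i) xs c zs |xs| |node| mxs mc mzs long with initLast xs | bigMeet-view (suc n) k mc long
  ... | []        | _ = ⊥-elim (0≢1+n |xs|)
  ... | xs′ ∷ʳ′ y | us , refl , |us| , mus with initLast us
  ...   | []        = ⊥-elim (0≢1+n |us|)
  ...   | ys ∷ʳ′ z with ++⁻ xs′ mxs | ++⁻ ys mus
  ...     | mxs′ , my ∷ [] | mys , mz ∷ [] =
    let |ys|                    = suc-injective (trans (sym (length-∷ʳ ys z)) |us|)
        (rotation , |node|′)    = leftRotation xs′ y ys z zs |ys| |node|
        (s , M∼s , ms , long-s) = pullLongLeft i xs′ _ (z ∷ zs) (suc-injective (trans (sym (length-∷ʳ xs′ y)) |xs|))
                                    |node|′ mxs′ (bigMeet-isMary (suc n) k (my ∷ mys) (cong suc |ys|)) (mz ∷ mzs)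
                                    (spine-bigMeet (suc n) k y ys)
    in s , rotation ◅◅ M∼s , ms , long-s

  pullLongToRoot : ∀ {s} → IsMary m s → Long s → LongAtRoot s
  pullLongToRoot ms (here long) = _ , ε , ms , long
  pullLongToRoot (node |node| mts) (there xs zs lc) with ++⁻ xs mts
  ... | mxs , mc ∷ mzs =
    let (c′ , c∼c′ , mc′ , long)  = pullLongToRoot mc lc
        (s , node∼s , ms , long-s) = pullLongLeft (length xs) xs c′ zs refl
                                       (trans (length-++-∷ xs zs) |node|) mxs mc′ mzs long
    in s , ∼-node xs zs c∼c′ ◅◅ node∼s , ms , long-s

  leaves-<-leavesL : ∀ y {ys} → All (IsMary m) ys → 1 ≤ length ys → leaves y < leavesL (y ∷ ys)
  leaves-<-leavesL y (my′ ∷ _) _ =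
    ≤-trans (≤-reflexive (+-comm 1 (leaves y))) (+-monoʳ-≤ (leaves y) (≤-trans (leaves-positive my′) (m≤m+n _ _)))

  -- One right rotation into the next sibling replaces c by the first tree of the meet at its root.
  splitLong : ∀ xs {c d} ds → length xs + 2 + length ds ≡ m → IsMary m c → IsMary m d → Long c →
    ∃₂ λ y M → node (xs ++ c ∷ d ∷ ds) ∼ node (xs ++ y ∷ M ∷ ds) × leaves y < leaves c × IsMary m y × IsMary m M
  splitLong xs {c} {d} ds |node| mc md lc with pullLongToRoot mc lc
  ... | c′ , c∼c′ , mc′ , long with bigMeet-view (suc n) k mc′ long
  ...   | [] , _ , () , _
  ...   | y ∷ ys , refl , |y∷ys| , my ∷ mys =
    y , bigMeet m k (ys ∷ʳ d) , ∼-node xs (d ∷ ds) c∼c′ ◅◅ (fwd (rightRotation xs y ys d ds |ys| |node|) ◅ ε) ,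
    y<c , my , bigMeet-isMary (suc n) k (++⁺ mys (md ∷ [])) (trans (length-∷ʳ ys d) |y∷ys|)
    where
    |ys| : length ys ≡ suc k * suc n
    |ys| = suc-injective |y∷ys|
    y<c : leaves y < leaves c
    y<c = ≤-trans (leaves-<-leavesL y mys (≤-trans (s≤s z≤n) (≤-reflexive (sym |ys|))))
                  (≤-reflexive (sym (trans (leaves-∼ c∼c′) (leaves-bigMeet m k (y ∷ ys)))))

  shorten : ∀ fuel xs {c d} ds → leaves c ≤ fuel → length xs + 2 + length ds ≡ m → IsMary m c → IsMary m d →
    ∃₂ λ c′ d′ → node (xs ++ c ∷ d ∷ ds) ∼ node (xs ++ c′ ∷ d′ ∷ ds) × Short c′ × IsMary m c′ × IsMary m d′
  shorten fuel xs {c} {d} ds bound |node| mc md with short-or-long c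
  ... | inj₁ sc = c , d , ε , sc , mc , md
  ... | inj₂ lc with splitLong xs ds |node| mc md lc | fuel
  ...   | y , M , c∼y , y<c , my , mM | zero = ⊥-elim (<-irrefl refl (≤-trans (≤-trans (s≤s z≤n) y<c) bound))
  ...   | y , M , c∼y , y<c , my , mM | suc fuel′ =
    let (c′ , d′ , y∼c′ , sc′ , mc′ , md′) = shorten fuel′ xs ds (s≤s⁻¹ (≤-trans y<c bound)) |node| my mM
    in c′ , d′ , c∼y ◅◅ y∼c′ , sc′ , mc′ , md′

  leaves-<-last : ∀ xs c → All (IsMary m) xs → length (xs ++ [ c ]) ≡ m → leaves c < leavesL (xs ++ [ c ])
  leaves-<-last (x ∷ xs) c (mx ∷ _) _ = +-mono-≤ (leaves-positive mx) (≤-trans (m≤n+m (leaves c) (leavesL xs))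
    (≤-reflexive (sym (trans (leavesL-++ xs [ c ]) (cong (leavesL xs +_) (+-identityʳ (leaves c)))))))

  NormalFormOf : Tree → Set
  NormalFormOf t = ∃ λ N → t ∼ N × IsMary m N × Normal N

  mutual
    normalize : ∀ fuel {t} → IsMary m t → leaves t ≤ fuel → NormalFormOf t
    normalize fuel       leaf                     _     = leaf , ε , leaf , leaf
    normalize zero       (node _ (mc ∷ _))        bound =
      ⊥-elim (<-irrefl refl (≤-trans (≤-trans (leaves-positive mc) (m≤m+n _ _)) bound))
    normalize (suc fuel) (node |c∷ds| (mc ∷ mds)) bound = normalizeChildren fuel [] [] [] mc mds |c∷ds| bound

    normalizeChildren : ∀ fuel xs {c ds} → All Short xs → All (IsMary m) xs → IsMary m c → All (IsMary m) ds →
      length (xs ++ c ∷ ds) ≡ m → leavesL (xs ++ c ∷ ds) ≤ suc fuel → NormalFormOf (node (xs ++ c ∷ ds))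
    normalizeChildren fuel xs {c} {[]} sxs mxs mc [] |node| bound =
      let (N , c∼N , mN , nN) = normalize fuel mc (s≤s⁻¹ (≤-trans (leaves-<-last xs c mxs |node|) bound))
      in node (xs ∷ʳ N) , ∼-node xs [] c∼N , node (trans (length-++-∷ xs []) |node|) (++⁺ mxs (mN ∷ [])) ,
         node xs N sxs nN
    normalizeChildren fuel xs {c} {d ∷ ds} sxs mxs mc (md ∷ mds) |node| bound =
      let (c′ , d′ , c∼c′ , sc′ , mc′ , md′) = shorten (leaves c) xs ds ≤-refl |node|′ mc md
          (N , c′∼N , mN , nN) = normalizeChildren fuel (xs ∷ʳ c′) (++⁺ sxs (sc′ ∷ [])) (++⁺ mxs (mc′ ∷ [])) md′ mds
                                   (trans (cong length reassoc) (trans (length-++-∷-∷ xs c′ d′ ds) |node|′))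
                                   (≤-trans (≤-reflexive (trans (cong leavesL reassoc) (sym (leaves-∼ c∼c′)))) bound)
      in N , c∼c′ ◅◅ subst (_∼ N) (cong node reassoc) c′∼N , mN , nN
      where
      |node|′ : length xs + 2 + length ds ≡ m
      |node|′ = trans (sym (length-++-∷-∷ xs c d ds)) |node|
      reassoc : ∀ {c′ d′} → (xs ∷ʳ c′) ++ d′ ∷ ds ≡ xs ++ c′ ∷ d′ ∷ ds
      reassoc {c′} {d′} = ∷ʳ-++ xs c′ (d′ ∷ ds)

  congruent⇒∼ : ∀ {t t′} → IsMary m t → IsMary m t′ →
    Congruent (suc k * suc n) (siblingDepth m t) (siblingDepth m t′) → t ∼ t′
  congruent⇒∼ {t} {t′} mt mt′ t≋t′ =
    let (N  , t∼N   , mN  , nN)  = normalize (leaves t) mt ≤-refl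
        (N′ , t′∼N′ , mN′ , nN′) = normalize (leaves t′) mt′ ≤-refl
        N≋N′ = congruent-trans (congruent-sym (kEquiv⇒congruent (suc n) k t∼N))
                 (congruent-trans t≋t′ (kEquiv⇒congruent (suc n) k t′∼N′))
    in t∼N ◅◅ subst (_∼ t′) (sym (normal-unique mN mN′ nN nN′ N≋N′)) (EC.symmetric (RightRot m (suc k)) t′∼N′)

-- The leaf-count hypotheses are unused: either side of the equivalence forces equal leaf counts.
theorem2p16 : ∀ (m k g : ℕ) → 2 ≤ m → 1 ≤ k →
    ∀ (t t' : Tree) → IsMary m t → IsMary m t' →
    leaves t ≡ m + g * (m ∸ 1) → leaves t' ≡ m + g * (m ∸ 1) →
    (KEquiv m k t t' ⇔
      Pointwise (λ a b → a ≡ b [mod k * (m ∸ 1) ]) (weightedDepth m t) (weightedDepth m t'))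
theorem2p16 (suc (suc n)) (suc k) _ (s≤s (s≤s z≤n)) (s≤s z≤n) t t′ mt mt′ _ _ = mk⇔
  (λ t∼t′ → subst₂ (Congruent (suc k * suc n)) (sym (depth≡ t)) (sym (depth≡ t′)) (kEquiv⇒congruent (suc n) k t∼t′))
  (λ t≋t′ → congruent⇒∼ mt mt′ (subst₂ (Congruent (suc k * suc n)) (depth≡ t) (depth≡ t′) t≋t′))
  where
  open NormalForms n k using (m; congruent⇒∼)
  depth≡ : ∀ s → weightedDepth m s ≡ siblingDepth m s
  depth≡ = weightedDepth≡pathWeights m
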